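{- Let $G$ be a connected block graph with at least one cut-vertex. Then there exists an independent Italian dominating function $f$ of $G$ with $w(f)=i_I(G)$ such that $f(v)\in\{0,1\}$ for every uncut-vertex $v$ of every block of type 1 of $G$.
   Context: A function $f:V(G)\to\{0,1,2\}$ is an Italian dominating function if every vertex $v$ with $f(v)=0$ satisfies $\sum_{u\in N(v)}f(u)\ge 2$; it is independent if $\{v:f(v)\neq 0\}$ is an independent set; $w(f)=\sum_v f(v)$; $i_I(G)$ is the minimum weight of an independent Italian dominating function of $G$. A block of a connected graph is a maximal connected subgraph without a cut-vertex; $G$ is a block graph if every block is a clique. An uncut-vertex of a block $B$ is a vertex of $B$ that is not a cut-vertex of $G$. A block $B$ with set of cut-vertices $C$ is of type 1 if $|B|=|C|+1$ (so it has exactly one uncut-vertex). -}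

module Defs where

open import Data.Nat using (ℕ; zero; suc; _+_; _≤_)
open import Data.Fin using (Fin)
import Data.Fin as F
open import Data.Fin.Subset using (Subset; _∈_; _⊆_; ⊤)
open import Data.Bool using (Bool; true; false; if_then_else_)
open import Data.Product using (Σ; _×_; ∃; ∃-syntax)
open import Relation.Binary.PropositionalEquality using (_≡_; _≢_)
open import Relation.Nullary using (¬_)

record Graph (n : ℕ) : Set where
  field
    adj    : Fin n → Fin n → Bool
    sym    : ∀ u v → adj u v ≡ adj v u
    irrefl : ∀ v → adj v v ≡ false
open Graph public

Adj : ∀ {n} → Graph n → Fin n → Fin n → Set
Adj G u v = adj G u v ≡ true

∑ : ∀ n → (Fin n → ℕ) → ℕ
∑ zero    g = 0
∑ (suc n) g = g F.zero + ∑ n (λ i → g (F.suc i))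

data WalkIn {n} (G : Graph n) (P : Fin n → Set) : Fin n → Fin n → Set where
  here : ∀ {u} → P u → WalkIn G P u u
  step : ∀ {u v w} → P u → Adj G u v → WalkIn G P v w → WalkIn G P u w

ConnectedOn : ∀ {n} → Graph n → Subset n → Set
ConnectedOn G S = (∃[ v ] v ∈ S) × (∀ u w → u ∈ S → w ∈ S → WalkIn G (_∈ S) u w)

CutVertexOn : ∀ {n} → Graph n → Subset n → Fin n → Set
CutVertexOn G S x =
  x ∈ S × (∃[ u ] ∃[ w ] (u ∈ S × w ∈ S × u ≢ x × w ≢ x
           × ¬ WalkIn G (λ v → v ∈ S × v ≢ x) u w))

full : ∀ {n} → Subset n
full = ⊤

Connected : ∀ {n} → Graph n → Set
Connected G = ConnectedOn G full

CutVertex : ∀ {n} → Graph n → Fin n → Set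
CutVertex G x = CutVertexOn G full x

NonSeparable : ∀ {n} → Graph n → Subset n → Set
NonSeparable G S = ConnectedOn G S × (∀ x → ¬ CutVertexOn G S x)

Block : ∀ {n} → Graph n → Subset n → Set
Block G S = NonSeparable G S × (∀ T → S ⊆ T → NonSeparable G T → T ⊆ S)

IsBlockGraph : ∀ {n} → Graph n → Set
IsBlockGraph G = ∀ B → Block G B → ∀ u v → u ∈ B → v ∈ B → u ≢ v → Adj G u v

UncutVertex : ∀ {n} → Graph n → Subset n → Fin n → Set
UncutVertex G B v = v ∈ B × ¬ CutVertex G v

-- Type 1 block: |B| = |C| + 1 where C = cut-vertices of G in B;
-- since C ⊆ B this says B has exactly one uncut-vertex.
Type1 : ∀ {n} → Graph n → Subset n → Set
Type1 G B = ∃[ u ] (UncutVertex G B u × (∀ w → UncutVertex G B w → w ≡ u))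

nbrSum : ∀ {n} → Graph n → (Fin n → ℕ) → Fin n → ℕ
nbrSum {n} G f v = ∑ n (λ u → if adj G v u then f u else 0)

weight : ∀ {n} → (Fin n → ℕ) → ℕ
weight {n} f = ∑ n f

IsItalianDom : ∀ {n} → Graph n → (Fin n → ℕ) → Set
IsItalianDom G f = (∀ v → f v ≤ 2) × (∀ v → f v ≡ 0 → 2 ≤ nbrSum G f v)

IsIndependentFn : ∀ {n} → Graph n → (Fin n → ℕ) → Set
IsIndependentFn G f = ∀ u v → f u ≢ 0 → f v ≢ 0 → ¬ Adj G u v

IsIIDF : ∀ {n} → Graph n → (Fin n → ℕ) → Set
IsIIDF G f = IsItalianDom G f × IsIndependentFn G f

IsMinIIDF : ∀ {n} → Graph n → (Fin n → ℕ) → Set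
IsMinIIDF G f = IsIIDF G f × (∀ g → IsIIDF G g → weight f ≤ weight g)

module Submission where

-- Start from a minimum-weight IIDF and repair it vertex by vertex. An uncut vertex v of a
-- block B has all its neighbours in B (a neighbour outside B, joined back to B avoiding v,
-- would close an ear and enlarge B), so in a block graph v is simplicial. If f v = 2, some
-- neighbour u of v has v as its only positive neighbour, since otherwise lowering f v to 1
-- would leave a lighter IIDF. Moving the value 2 from v to u keeps f an IIDF of the same
-- weight, because every other neighbour of v is adjacent to u. This never spoils another
-- vertex: u is adjacent to the uncut vertex v, so it is not the unique uncut vertex of a
-- type-1 block.

open import Defs hiding (sym)
open import Data.Bool using (true; false; if_then_else_)
import Data.Bool as Bool
open import Data.Empty using (⊥-elim)
open import Data.Fin using (Fin; zero; suc)
open import Data.Fin.Properties using (any?; all?) renaming (_≟_ to _≟ᶠ_; suc-injective to Fin-suc-injective)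
open import Data.Fin.Subset using (Subset; ⊤; _∪_; ⁅_⁆)
  renaming (_∈_ to _∈ˢ_; _∉_ to _∉ˢ_; _⊆_ to _⊆ˢ_; ⊥ to ∅)
open import Data.Fin.Subset.Properties using (∈⊤; ∉⊥; x∈⁅x⁆; x∈⁅y⁆⇒x≡y; x∈p∪q⁺; x∈p∪q⁻; _∈?_)
open import Data.List using (List; []; _∷_; _++_; [_]; allFin)
open import Data.List.Properties using (++-assoc)
open import Data.List.Membership.Propositional using (_∈_; _∉_)
open import Data.List.Membership.Propositional.Properties using (∈-++⁺ˡ; ∈-++⁺ʳ; ∈-++⁻; ∈-∃++; ∈-allFin)
open import Data.List.Relation.Unary.All using (All; []; _∷_)
import Data.List.Relation.Unary.All as All
open import Data.List.Relation.Unary.All.Properties using (¬Any⇒All¬; All¬⇒¬Any)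
open import Data.List.Relation.Unary.Any using (here; there)
open import Data.List.Relation.Unary.AllPairs using ([]; _∷_)
open import Data.List.Relation.Unary.Linked using (Linked; []; [-]; _∷_)
import Data.List.Relation.Unary.Linked as Linked
open import Data.List.Relation.Unary.Unique.Propositional using (Unique)
open import Data.Nat using (ℕ; zero; suc; _+_; _∸_; _≤_; _<_; _≤?_; _<?_; z≤n; s≤s; z<s) renaming (_≟_ to _≟ⁿ_)
open import Data.Nat.Induction using (<-wellFounded)
open import Data.Nat.Properties
open import Data.Product using (_×_; ∃; ∃-syntax; _,_; proj₁; proj₂)
open import Data.Sum using (_⊎_; inj₁; inj₂)
import Data.Sum as Sum
open import Data.Vec.Functional using (updateAt) renaming (_∷_ to _◂_)
open import Data.Vec.Functional.Properties using (updateAt-updates; updateAt-minimal)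
open import Function using (const; _∘_)
open import Induction.WellFounded using (Acc; acc)
open import Relation.Binary.PropositionalEquality hiding ([_])
open import Relation.Nullary using (¬_; Dec; yes; no; contradiction)
open import Relation.Nullary.Decidable using (_×-dec_; _→-dec_; ¬?; map′; decidable-stable)
open import Relation.Unary using (Decidable)

∑-cong : ∀ n {f g : Fin n → ℕ} → (∀ i → f i ≡ g i) → ∑ n f ≡ ∑ n g
∑-cong zero    f≗g = refl
∑-cong (suc n) f≗g = cong₂ _+_ (f≗g zero) (∑-cong n (f≗g ∘ suc))

≤-∑ : ∀ n (f : Fin n → ℕ) i → f i ≤ ∑ n f
≤-∑ (suc n) f zero    = m≤m+n _ _
≤-∑ (suc n) f (suc i) = ≤-trans (≤-∑ n (f ∘ suc) i) (m≤n+m _ _)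

+-≤-∑ : ∀ n (f : Fin n → ℕ) {i j} → i ≢ j → f i + f j ≤ ∑ n f
+-≤-∑ (suc n) f {zero}  {zero}  i≢j = contradiction refl i≢j
+-≤-∑ (suc n) f {zero}  {suc j} i≢j = +-monoʳ-≤ (f zero) (≤-∑ n (f ∘ suc) j)
+-≤-∑ (suc n) f {suc i} {zero}  i≢j =
  subst (_≤ ∑ (suc n) f) (+-comm (f zero) (f (suc i))) (+-monoʳ-≤ (f zero) (≤-∑ n (f ∘ suc) i))
+-≤-∑ (suc n) f {suc i} {suc j} i≢j =
  ≤-trans (+-≤-∑ n (f ∘ suc) (i≢j ∘ cong suc)) (m≤n+m _ _)

-- Stated with both sides moved so that no subtraction occurs.
∑-except : ∀ n (f g : Fin n → ℕ) i → (∀ j → j ≢ i → f j ≡ g j) → ∑ n f + g i ≡ ∑ n g + f i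
∑-except (suc n) f g zero f≗g = begin
  f zero + ∑ n (f ∘ suc) + g zero  ≡⟨ cong (λ s → f zero + s + g zero) (∑-cong n λ j → f≗g (suc j) λ ()) ⟩
  f zero + ∑ n (g ∘ suc) + g zero  ≡⟨ +-comm (f zero + _) (g zero) ⟩
  g zero + (f zero + ∑ n (g ∘ suc)) ≡⟨ cong (g zero +_) (+-comm (f zero) _) ⟩
  g zero + (∑ n (g ∘ suc) + f zero) ≡⟨ +-assoc (g zero) _ _ ⟨
  g zero + ∑ n (g ∘ suc) + f zero  ∎
  where open ≡-Reasoning
∑-except (suc n) f g (suc i) f≗g = begin
  f zero + ∑ n (f ∘ suc) + g (suc i)   ≡⟨ +-assoc (f zero) _ _ ⟩
  f zero + (∑ n (f ∘ suc) + g (suc i)) ≡⟨ cong₂ _+_ (f≗g zero λ ()) (∑-except n (f ∘ suc) (g ∘ suc) i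
                                            λ j j≢i → f≗g (suc j) (j≢i ∘ Fin-suc-injective)) ⟩
  g zero + (∑ n (g ∘ suc) + f (suc i)) ≡⟨ +-assoc (g zero) _ _ ⟨
  g zero + ∑ n (g ∘ suc) + f (suc i)   ∎
  where open ≡-Reasoning

weight-updateAt : ∀ {n} (f : Fin n → ℕ) i a → weight (updateAt f i (const a)) + f i ≡ weight f + a
weight-updateAt {n} f i a =
  subst (λ b → weight (updateAt f i (const a)) + f i ≡ weight f + b) (updateAt-updates i f)
        (∑-except n _ f i λ j j≢i → updateAt-minimal j i f j≢i)

updateAt-const : ∀ {n} (f : Fin n → ℕ) v a i →
  (i ≡ v × updateAt f v (const a) i ≡ a) ⊎ (i ≢ v × updateAt f v (const a) i ≡ f i)
updateAt-const f v a i with i ≟ᶠ v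
... | yes refl = inj₁ (refl , updateAt-updates v f)
... | no i≢v   = inj₂ (i≢v , updateAt-minimal i v f i≢v)

shift : ∀ {n} → (Fin n → ℕ) → Fin n → Fin n → Fin n → ℕ
shift f v u = updateAt (updateAt f v (const 0)) u (const 2)

shift-elsewhere : ∀ {n} (f : Fin n → ℕ) {v u a} → a ≢ u → a ≢ v → shift f v u a ≡ f a
shift-elsewhere f {v} {u} {a} a≢u a≢v =
  trans (updateAt-minimal a u _ a≢u) (updateAt-minimal a v f a≢v)

shift-cases : ∀ {n} (f : Fin n → ℕ) v u a →
  (a ≡ u × shift f v u a ≡ 2) ⊎ (a ≡ v × a ≢ u × shift f v u a ≡ 0) ⊎ (a ≢ u × a ≢ v × shift f v u a ≡ f a)
shift-cases f v u a with a ≟ᶠ u | a ≟ᶠ v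
... | yes refl | _        = inj₁ (refl , updateAt-updates u _)
... | no a≢u   | yes refl = inj₂ (inj₁ (refl , a≢u , trans (updateAt-minimal a u _ a≢u) (updateAt-updates v f)))
... | no a≢u   | no a≢v   = inj₂ (inj₂ (a≢u , a≢v , shift-elsewhere f a≢u a≢v))

weight-shift : ∀ {n} (f : Fin n → ℕ) {v u} → u ≢ v → f u ≡ 0 → f v ≡ 2 → weight (shift f v u) ≡ weight f
weight-shift f {v} {u} u≢v fu≡0 fv≡2 = begin
  weight (shift f v u)              ≡⟨ +-identityʳ _ ⟨
  weight (shift f v u) + 0          ≡⟨ cong (weight (shift f v u) +_) (trans (updateAt-minimal u v f u≢v) fu≡0) ⟨
  weight (shift f v u) + f₀ u       ≡⟨ weight-updateAt f₀ u 2 ⟩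
  weight f₀ + 2                     ≡⟨ cong (weight f₀ +_) fv≡2 ⟨
  weight f₀ + f v                   ≡⟨ weight-updateAt f v 0 ⟩
  weight f + 0                      ≡⟨ +-identityʳ _ ⟩
  weight f                          ∎
  where
  open ≡-Reasoning
  f₀ = updateAt f v (const 0)

Extensional : ∀ {k} → ((Fin k → ℕ) → Set) → Set
Extensional P = ∀ {f g} → (∀ i → f i ≡ g i) → P f → P g

bounded-search : ∀ k b {P : (Fin k → ℕ) → Set} → Extensional P → Decidable P →
                 Dec (∃ λ f → (∀ i → f i < b) × P f)
bounded-search zero    b ext P? =
  map′ (λ p → none , (λ ()) , p) (λ (f , _ , pf) → ext (λ ()) pf) (P? none)
  where
  none : Fin 0 → ℕ
  none ()
bounded-search (suc k) b ext P? =
  map′ (λ (a , a<b , h , h<b , p) → a ◂ h , (λ { zero → a<b ; (suc i) → h<b i }) , p)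
       (λ (f , f<b , pf) → f zero , f<b zero , f ∘ suc , f<b ∘ suc , ext (λ { zero → refl ; (suc i) → refl }) pf)
       (anyUpTo? (λ a → bounded-search k b (λ h≗ → ext λ { zero → refl ; (suc i) → h≗ i }) (P? ∘ (a ◂_))) b)

minimal-weight : ∀ {n} b {P : (Fin n → ℕ) → Set} → Extensional P → Decidable P →
                 (∀ {f} → P f → ∀ i → f i < b) → ∃ P →
                 ∃ λ f → P f × (∀ g → P g → weight f ≤ weight g)
minimal-weight {n} b {P} ext P? bounded (f₀ , pf₀) = descend f₀ pf₀ (<-wellFounded (weight f₀))
  where
  descend : ∀ f → P f → Acc _<_ (weight f) → ∃ λ f → P f × (∀ g → P g → weight f ≤ weight g)
  descend f pf (acc rs)
    with bounded-search n b {λ g → P g × weight g < weight f}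
           (λ f≗g (pg , g<f) → ext f≗g pg , subst (_< weight f) (∑-cong n f≗g) g<f)
           (λ g → P? g ×-dec (weight g <? weight f))
  ... | yes (g , _ , pg , g<f) = descend g pg (rs g<f)
  ... | no ∄lighter = f , pf , λ g pg → ≮⇒≥ λ g<f → ∄lighter (g , bounded pg , pg , g<f)

toSubset : ∀ {n} → List (Fin n) → Subset n
toSubset []       = ∅
toSubset (a ∷ as) = ⁅ a ⁆ ∪ toSubset as

∈-toSubset⁺ : ∀ {n} {a : Fin n} {as} → a ∈ as → a ∈ˢ toSubset as
∈-toSubset⁺ (here refl)  = x∈p∪q⁺ (inj₁ (x∈⁅x⁆ _))
∈-toSubset⁺ (there a∈as) = x∈p∪q⁺ (inj₂ (∈-toSubset⁺ a∈as))

∈-toSubset⁻ : ∀ {n} {a : Fin n} as → a ∈ˢ toSubset as → a ∈ as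
∈-toSubset⁻ []       a∈∅ = contradiction a∈∅ ∉⊥
∈-toSubset⁻ (b ∷ bs) a∈  with x∈p∪q⁻ ⁅ b ⁆ (toSubset bs) a∈
... | inj₁ a∈⁅b⁆  = here (x∈⁅y⁆⇒x≡y b a∈⁅b⁆)
... | inj₂ a∈bs   = there (∈-toSubset⁻ bs a∈bs)

Linked-++⁻ˡ : ∀ {A : Set} {R : A → A → Set} xs {ys} → Linked R (xs ++ ys) → Linked R xs
Linked-++⁻ˡ []             _             = []
Linked-++⁻ˡ (x ∷ [])       _             = [-]
Linked-++⁻ˡ (x ∷ y ∷ xs) (Rxy ∷ linked) = Rxy ∷ Linked-++⁻ˡ (y ∷ xs) linked

Linked-++⁻ʳ : ∀ {A : Set} {R : A → A → Set} xs {ys} → Linked R (xs ++ ys) → Linked R ys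
Linked-++⁻ʳ []       linked = linked
Linked-++⁻ʳ (x ∷ xs) linked = Linked-++⁻ʳ xs (Linked.tail linked)

Unique-split : ∀ {A : Set} xs {z : A} {ys} → Unique (xs ++ z ∷ ys) → z ∉ xs × z ∉ ys
Unique-split []       (z∉ys ∷ _) = (λ ()) , All¬⇒¬Any z∉ys
Unique-split (x ∷ xs) (x∉ ∷ unique) with Unique-split xs unique
... | z∉xs , z∉ys = (λ { (here refl)  → All.lookup x∉ (∈-++⁺ʳ xs (here refl)) refl
                       ; (there z∈xs) → z∉xs z∈xs })
                  , z∉ys

module _ {n} (G : Graph n) where

  Adj? : ∀ u v → Dec (Adj G u v)
  Adj? u v = adj G u v Bool.≟ true

  Adj-sym : ∀ {u v} → Adj G u v → Adj G v u
  Adj-sym {u} {v} = trans (Graph.sym G v u)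

  Adj⇒≢ : ∀ {u v} → Adj G u v → u ≢ v
  Adj⇒≢ {u} uv refl with trans (sym uv) (irrefl G u)
  ... | ()

  private
    nbrTerm : ∀ (f : Fin n → ℕ) {w u} → Adj G w u → (if adj G w u then f u else 0) ≡ f u
    nbrTerm f wu rewrite wu = refl

  ≤-nbrSum : ∀ (f : Fin n → ℕ) {w u} → Adj G w u → f u ≤ nbrSum G f w
  ≤-nbrSum f {w} {u} wu = subst (_≤ nbrSum G f w) (nbrTerm f wu) (≤-∑ n _ u)

  +-≤-nbrSum : ∀ (f : Fin n → ℕ) {w a b} → Adj G w a → Adj G w b → a ≢ b → f a + f b ≤ nbrSum G f w
  +-≤-nbrSum f {w} wa wb a≢b =
    subst (_≤ nbrSum G f w) (cong₂ _+_ (nbrTerm f wa) (nbrTerm f wb)) (+-≤-∑ n _ a≢b)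

  nbrSum-cong : ∀ {f g : Fin n → ℕ} w → (∀ u → Adj G w u → f u ≡ g u) → nbrSum G f w ≡ nbrSum G g w
  nbrSum-cong {f} {g} w f≗g = ∑-cong n term
    where
    term : ∀ u → (if adj G w u then f u else 0) ≡ (if adj G w u then g u else 0)
    term u with adj G w u in wu
    ... | true  = f≗g u wu
    ... | false = refl

module Walk {n} {G : Graph n} where

  head : ∀ {P u w} → WalkIn G P u w → P u
  head (here p)     = p
  head (step p _ _) = p

  map : ∀ {P Q : Fin n → Set} → (∀ {a} → P a → Q a) → ∀ {u w} → WalkIn G P u w → WalkIn G Q u w
  map P⇒Q (here p)        = here (P⇒Q p)
  map P⇒Q (step p uv vw) = step (P⇒Q p) uv (map P⇒Q vw)

  infixr 5 _◅◅_
  _◅◅_ : ∀ {P u v w} → WalkIn G P u v → WalkIn G P v w → WalkIn G P u w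
  here _       ◅◅ vw = vw
  step p a uv ◅◅ vw = step p a (uv ◅◅ vw)

  reverse : ∀ {P u w} → WalkIn G P u w → WalkIn G P w u
  reverse (here p)      = here p
  reverse (step p a vw) = reverse vw ◅◅ step (head vw) (Adj-sym G a) (here p)

  along : ∀ {L a b} → Linked (Adj G) L → a ∈ L → b ∈ L → WalkIn G (_∈ L) a b
  along {h ∷ _} linked a∈L b∈L = toHead linked a∈L ◅◅ reverse (toHead linked b∈L)
    where
    toHead : ∀ {h t a} → Linked (Adj G) (h ∷ t) → a ∈ h ∷ t → WalkIn G (_∈ h ∷ t) a h
    toHead _              (here refl) = here (here refl)
    toHead (hh′ ∷ linked) (there a∈t) =
      map there (toHead linked a∈t) ◅◅ step (there (here refl)) (Adj-sym G hh′) (here (here refl))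

module _ {n} (G : Graph n) where

  IsIIDF? : Decidable (IsIIDF G)
  IsIIDF? f = ((all? λ v → f v ≤? 2) ×-dec (all? λ v → f v ≟ⁿ 0 →-dec 2 ≤? nbrSum G f v))
              ×-dec (all? λ u → all? λ v → ¬? (f u ≟ⁿ 0) →-dec ¬? (f v ≟ⁿ 0) →-dec ¬? (Adj? G u v))

  IsIIDF-ext : Extensional (IsIIDF G)
  IsIIDF-ext f≗g ((bounded , italian) , indep) =
    ( (λ v → subst (_≤ 2) (f≗g v) (bounded v))
    , (λ v gv≡0 → subst (2 ≤_) (nbrSum-cong G v λ u _ → f≗g u) (italian v (trans (f≗g v) gv≡0))) )
    , λ u v gu≢0 gv≢0 → indep u v (gu≢0 ∘ trans (sym (f≗g u))) (gv≢0 ∘ trans (sym (f≗g v)))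

  -- With values in {0, 2} an undominated vertex has no positive neighbour, so it can be given 2.
  IIDF-exists : ∃ (IsIIDF G)
  IIDF-exists = grow (const 0) (λ _ _ 0≢0 → contradiction refl 0≢0) (λ _ → inj₁ refl) (<-wellFounded _)
    where
    deficit : (Fin n → ℕ) → ℕ
    deficit f = ∑ n (λ i → 2 ∸ f i)

    grow : ∀ f → IsIndependentFn G f → (∀ v → f v ≡ 0 ⊎ f v ≡ 2) → Acc _<_ (deficit f) → ∃ (IsIIDF G)
    grow f indep f∈02 (acc rs) with any? (λ v → (f v ≟ⁿ 0) ×-dec (nbrSum G f v <? 2))
    ... | no ∄undominated =
      f , ((bounded , λ v fv≡0 → ≮⇒≥ λ small → ∄undominated (v , fv≡0 , small)) , indep)
      where
      bounded : ∀ v → f v ≤ 2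
      bounded v with f∈02 v
      ... | inj₁ fv≡0 = ≤-trans (≤-reflexive fv≡0) z≤n
      ... | inj₂ fv≡2 = ≤-reflexive fv≡2
    ... | yes (v , fv≡0 , small) = grow f′ indep′ f′∈02 (rs deficit-drops)
      where
      f′ = updateAt f v (const 2)

      quiet : ∀ u → Adj G v u → f u ≡ 0
      quiet u vu with f∈02 u
      ... | inj₁ fu≡0 = fu≡0
      ... | inj₂ fu≡2 = contradiction (subst (_≤ nbrSum G f v) fu≡2 (≤-nbrSum G f vu)) (<⇒≱ small)

      indep′ : IsIndependentFn G f′
      indep′ a b fa≢0 fb≢0 ab with updateAt-const f v 2 a | updateAt-const f v 2 b
      ... | inj₁ (refl , _)    | inj₁ (refl , _)    = Adj⇒≢ G ab refl
      ... | inj₁ (refl , _)    | inj₂ (_ , f′b≡fb) = fb≢0 (trans f′b≡fb (quiet b ab))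
      ... | inj₂ (_ , f′a≡fa) | inj₁ (refl , _)    = fa≢0 (trans f′a≡fa (quiet a (Adj-sym G ab)))
      ... | inj₂ (_ , f′a≡fa) | inj₂ (_ , f′b≡fb) =
        indep a b (fa≢0 ∘ trans f′a≡fa) (fb≢0 ∘ trans f′b≡fb) ab

      f′∈02 : ∀ u → f′ u ≡ 0 ⊎ f′ u ≡ 2
      f′∈02 u with updateAt-const f v 2 u
      ... | inj₁ (_ , f′u≡2)  = inj₂ f′u≡2
      ... | inj₂ (_ , f′u≡fu) = Sum.map (trans f′u≡fu) (trans f′u≡fu) (f∈02 u)

      deficit-drops : deficit f′ < deficit f
      deficit-drops = subst (deficit f′ <_) (begin
        deficit f′ + 2           ≡⟨ cong (λ a → deficit f′ + (2 ∸ a)) fv≡0 ⟨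
        deficit f′ + (2 ∸ f v)   ≡⟨ ∑-except n _ _ v (λ u u≢v → cong (2 ∸_) (updateAt-minimal u v f u≢v)) ⟩
        deficit f + (2 ∸ f′ v)   ≡⟨ cong (λ a → deficit f + (2 ∸ a)) (updateAt-updates v f) ⟩
        deficit f + 0            ≡⟨ +-identityʳ _ ⟩
        deficit f                ∎) (m<m+n _ z<s)
        where open ≡-Reasoning

  minimum-IIDF : ∃ (IsMinIIDF G)
  minimum-IIDF = minimal-weight 3 IsIIDF-ext IsIIDF? (λ ((bounded , _) , _) i → s≤s (bounded i)) IIDF-exists

module _ {n} (G : Graph n) where

  open import Data.List.Membership.DecPropositional (_≟ᶠ_ {n}) using () renaming (_∈?_ to _∈ˡ?_)

  edge-nonseparable : ∀ {u w} → Adj G u w → NonSeparable G (⁅ u ⁆ ∪ ⁅ w ⁆)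
  edge-nonseparable {u} {w} uw = ((u , x∈p∪q⁺ (inj₁ (x∈⁅x⁆ u))) , joined) , no-cut
    where
    T = ⁅ u ⁆ ∪ ⁅ w ⁆

    members : ∀ {a} → a ∈ˢ T → a ≡ u ⊎ a ≡ w
    members {a} a∈T = Sum.map (x∈⁅y⁆⇒x≡y u) (x∈⁅y⁆⇒x≡y w) (x∈p∪q⁻ ⁅ u ⁆ ⁅ w ⁆ a∈T)

    joined : ∀ a b → a ∈ˢ T → b ∈ˢ T → WalkIn G (_∈ˢ T) a b
    joined a b a∈T b∈T with members a∈T | members b∈T
    ... | inj₁ refl | inj₁ refl = here a∈T
    ... | inj₁ refl | inj₂ refl = step a∈T uw (here b∈T)
    ... | inj₂ refl | inj₁ refl = step a∈T (Adj-sym G uw) (here b∈T)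
    ... | inj₂ refl | inj₂ refl = here a∈T

    same : ∀ {a b z} → a ≡ u ⊎ a ≡ w → b ≡ u ⊎ b ≡ w → z ≡ u ⊎ z ≡ w → a ≢ z → b ≢ z → a ≡ b
    same (inj₁ refl) (inj₁ refl) _           _   _   = refl
    same (inj₂ refl) (inj₂ refl) _           _   _   = refl
    same (inj₁ refl) (inj₂ refl) (inj₁ refl) a≢z _   = contradiction refl a≢z
    same (inj₁ refl) (inj₂ refl) (inj₂ refl) _   b≢z = contradiction refl b≢z
    same (inj₂ refl) (inj₁ refl) (inj₁ refl) _   b≢z = contradiction refl b≢z
    same (inj₂ refl) (inj₁ refl) (inj₂ refl) a≢z _   = contradiction refl a≢z

    no-cut : ∀ z → ¬ CutVertexOn G T z
    no-cut z (z∈T , a , b , a∈T , b∈T , a≢z , b≢z , ¬walk) =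
      ¬walk (subst (WalkIn G _ a) (same (members a∈T) (members b∈T) (members z∈T) a≢z b≢z) (here (a∈T , a≢z)))

  record PathInto (B : Subset n) (v s : Fin n) : Set where
    constructor path
    field
      rest    : List (Fin n)
      end     : Fin n
      end∈B   : end ∈ˢ B
      end≢v   : end ≢ v
      linked  : Linked (Adj G) (s ∷ rest ++ [ end ])
      unique  : Unique (s ∷ rest)
      outside : All (_∉ˢ B) (s ∷ rest)

  module _ {B : Subset n} {v : Fin n} where

    PathInto-suffix : ∀ {a s} (p : PathInto B v a) → s ∈ a ∷ PathInto.rest p → PathInto B v s
    PathInto-suffix p (here refl) = p
    PathInto-suffix (path (_ ∷ rest) end end∈B end≢v (_ ∷ linked) (_ ∷ unique) (_ ∷ outside)) (there s∈) =
      PathInto-suffix (path rest end end∈B end≢v linked unique outside) s∈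

    -- Loop erasure: prepend s, cutting back to its earlier occurrence if there is one.
    PathInto-from-walk : ∀ {s y} → s ∉ˢ B → y ∈ˢ B → WalkIn G (λ a → a ∈ˢ ⊤ × a ≢ v) s y → PathInto B v s
    PathInto-from-walk s∉B y∈B (here _) = contradiction y∈B s∉B
    PathInto-from-walk s∉B y∈B (step {v = a} _ sa aW) with a ∈? B
    ... | yes a∈B = path [] a a∈B (proj₂ (Walk.head aW)) (sa ∷ [-]) ([] ∷ []) (s∉B ∷ [])
    ... | no a∉B with PathInto-from-walk a∉B y∈B aW
    ...   | p@(path rest end end∈B end≢v linked unique outside) with _ ∈ˡ? a ∷ rest
    ...     | yes s∈ = PathInto-suffix p s∈
    ...     | no s∉  = path (a ∷ rest) end end∈B end≢v (sa ∷ linked) (¬Any⇒All¬ _ s∉ ∷ unique) (s∉B ∷ outside)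

  -- Closed up by the edge v x, the path is an ear of B, so B ∪ path is still nonseparable.
  module Ear {B : Subset n} (nonsep : NonSeparable G B) {v x : Fin n} (v∈B : v ∈ˢ B) (vx : Adj G v x)
             (p : PathInto B v x) where

    open PathInto p

    inner : List (Fin n)
    inner = x ∷ rest

    T : Subset n
    T = B ∪ toSubset inner

    ear : List (Fin n)
    ear = v ∷ inner ++ [ end ]

    B⊆T : ∀ {a} → a ∈ˢ B → a ∈ˢ T
    B⊆T a∈B = x∈p∪q⁺ (inj₁ a∈B)

    inner⊆T : ∀ {a} → a ∈ inner → a ∈ˢ T
    inner⊆T a∈inner = x∈p∪q⁺ (inj₂ (∈-toSubset⁺ a∈inner))

    ear⊆T : ∀ {a} → a ∈ ear → a ∈ˢ T
    ear⊆T (here refl) = B⊆T v∈B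
    ear⊆T (there a∈) with ∈-++⁻ inner a∈
    ... | inj₁ a∈inner    = inner⊆T a∈inner
    ... | inj₂ (here refl) = B⊆T end∈B

    inner-outside : ∀ {a} → a ∈ inner → a ∉ˢ B
    inner-outside = All.lookup outside

    walk-avoiding : ∀ {L z a b} → Linked (Adj G) L → (∀ {q} → q ∈ L → q ∈ ear) → z ∉ L →
                    a ∈ L → b ∈ L → WalkIn G (λ q → q ∈ˢ T × q ≢ z) a b
    walk-avoiding linked L⊆ear z∉L a∈L b∈L =
      Walk.map (λ q∈L → ear⊆T (L⊆ear q∈L) , λ { refl → z∉L q∈L }) (Walk.along linked a∈L b∈L)

    Reaches-B-avoiding : Fin n → Fin n → Set
    Reaches-B-avoiding z a = ∃ λ b → b ∈ˢ B × b ≢ z × WalkIn G (λ q → q ∈ˢ T × q ≢ z) a b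

    -- Split the ear at z: the part before z leads back to v, the part after it on to end.
    inner-reaches-B : ∀ {z a} → a ∈ inner → a ≢ z → Reaches-B-avoiding z a
    inner-reaches-B {z} a∈inner a≢z with z ∈ˡ? inner
    ... | yes z∈inner = split (∈-∃++ z∈inner)
      where
      z∉B = inner-outside z∈inner

      split : (∃ λ pre → ∃ λ post → inner ≡ pre ++ z ∷ post) → Reaches-B-avoiding z _
      split (pre , post , eq) =
        around (Unique-split pre (subst Unique eq unique)) (∈-++⁻ pre (subst (_ ∈_) eq a∈inner))
        where
        ear≡ : ear ≡ (v ∷ pre) ++ z ∷ post ++ [ end ]
        ear≡ = cong (v ∷_) (trans (cong (_++ [ end ]) eq) (++-assoc pre (z ∷ post) [ end ]))

        linked′ : Linked (Adj G) ((v ∷ pre) ++ z ∷ post ++ [ end ])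
        linked′ = subst (Linked (Adj G)) ear≡ (vx ∷ linked)

        ⊆ear : ∀ {q} → q ∈ (v ∷ pre) ++ z ∷ post ++ [ end ] → q ∈ ear
        ⊆ear {q} = subst (q ∈_) (sym ear≡)

        around : z ∉ pre × z ∉ post → _ ∈ pre ⊎ _ ∈ z ∷ post → Reaches-B-avoiding z _
        around (z∉pre , _) (inj₁ a∈pre) =
          v , v∈B , (λ { refl → z∉B v∈B }) ,
          walk-avoiding (Linked-++⁻ˡ (v ∷ pre) linked′) (⊆ear ∘ ∈-++⁺ˡ)
            (λ { (here refl) → z∉B v∈B ; (there z∈pre) → z∉pre z∈pre }) (there a∈pre) (here refl)
        around _ (inj₂ (here refl)) = contradiction refl a≢z
        around (_ , z∉post) (inj₂ (there a∈post)) =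
          end , end∈B , (λ { refl → z∉B end∈B }) ,
          walk-avoiding (Linked.tail (Linked-++⁻ʳ (v ∷ pre) linked′)) (⊆ear ∘ ∈-++⁺ʳ (v ∷ pre) ∘ there)
            (λ z∈ → Sum.[ z∉post , (λ { (here refl) → z∉B end∈B }) ] (∈-++⁻ post z∈))
            (∈-++⁺ˡ a∈post) (∈-++⁺ʳ post (here refl))
    ... | no z∉inner with end ≟ᶠ z
    ...   | yes refl =
      v , v∈B , end≢v ∘ sym ,
      walk-avoiding (Linked-++⁻ˡ (v ∷ inner) (vx ∷ linked)) ∈-++⁺ˡ
        (λ { (here refl) → end≢v refl ; (there z∈) → z∉inner z∈ }) (there a∈inner) (here refl)
    ...   | no end≢z =
      end , end∈B , end≢z ,
      walk-avoiding linked there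
        (λ z∈ → Sum.[ z∉inner , (λ { (here refl) → end≢z refl }) ] (∈-++⁻ inner z∈))
        (∈-++⁺ˡ a∈inner) (∈-++⁺ʳ inner (here refl))

    reaches-B : ∀ {z a} → a ∈ˢ T → a ≢ z → Reaches-B-avoiding z a
    reaches-B {a = a} a∈T a≢z with x∈p∪q⁻ B (toSubset inner) a∈T
    ... | inj₁ a∈B     = a , a∈B , a≢z , here (a∈T , a≢z)
    ... | inj₂ a∈inner = inner-reaches-B (∈-toSubset⁻ inner a∈inner) a≢z

    B-joined-avoiding : ∀ {z b b′} → b ∈ˢ B → b′ ∈ˢ B → b ≢ z → b′ ≢ z →
                        ¬ ¬ WalkIn G (λ q → q ∈ˢ T × q ≢ z) b b′
    B-joined-avoiding {z} {b} {b′} b∈B b′∈B b≢z b′≢z ¬walk with z ∈? B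
    ... | yes z∈B = proj₂ nonsep z (z∈B , b , b′ , b∈B , b′∈B , b≢z , b′≢z ,
                                    ¬walk ∘ Walk.map λ (q∈B , q≢z) → B⊆T q∈B , q≢z)
    ... | no z∉B  = ¬walk (Walk.map (λ q∈B → B⊆T q∈B , λ { refl → z∉B q∈B })
                                    (proj₂ (proj₁ nonsep) b b′ b∈B b′∈B))

    nonseparable : NonSeparable G T
    nonseparable = ((v , B⊆T v∈B) , λ a b a∈T b∈T → to-v a∈T Walk.◅◅ Walk.reverse (to-v b∈T)) , no-cut
      where
      to-v : ∀ {a} → a ∈ˢ T → WalkIn G (_∈ˢ T) a v
      to-v {a} a∈T with x∈p∪q⁻ B (toSubset inner) a∈T
      ... | inj₁ a∈B     = Walk.map B⊆T (proj₂ (proj₁ nonsep) a v a∈B v∈B)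
      ... | inj₂ a∈inner =
        Walk.map ear⊆T (Walk.along (vx ∷ linked) (there (∈-++⁺ˡ (∈-toSubset⁻ inner a∈inner))) (here refl))

      no-cut : ∀ z → ¬ CutVertexOn G T z
      no-cut z (_ , a , b , a∈T , b∈T , a≢z , b≢z , ¬walk)
        with reaches-B a∈T a≢z | reaches-B b∈T b≢z
      ... | a′ , a′∈B , a′≢z , aa′ | b′ , b′∈B , b′≢z , bb′ =
        B-joined-avoiding a′∈B b′∈B a′≢z b′≢z λ a′b′ → ¬walk (aa′ Walk.◅◅ a′b′ Walk.◅◅ Walk.reverse bb′)

  neighbour∈block : ∀ {B v x} → Block G B → v ∈ˢ B → ¬ CutVertex G v → Adj G v x → x ∈ˢ B
  neighbour∈block {B} {v} {x} (nonsep , maximal) v∈B v-uncut vx with x ∈? B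
  ... | yes x∈B = x∈B
  ... | no x∉B with any? (λ y → (y ∈? B) ×-dec ¬? (y ≟ᶠ v))
  ...   | yes (y , y∈B , y≢v) =
    ⊥-elim (v-uncut (∈⊤ , x , y , ∈⊤ , ∈⊤ , Adj⇒≢ G vx ∘ sym , y≢v , x∉B ∘ x∈B ∘ PathInto-from-walk x∉B y∈B))
    where
    x∈B : PathInto B v x → x ∈ˢ B
    x∈B p = maximal _ B⊆T nonseparable (inner⊆T (here refl))
      where open Ear nonsep v∈B vx p
  ...   | no ∄other = contradiction (maximal _ B⊆edge (edge-nonseparable vx) (x∈p∪q⁺ (inj₂ (x∈⁅x⁆ x)))) x∉B
    where
    B⊆edge : B ⊆ˢ ⁅ v ⁆ ∪ ⁅ x ⁆
    B⊆edge {b} b∈B with b ≟ᶠ v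
    ... | yes refl = x∈p∪q⁺ (inj₁ (x∈⁅x⁆ v))
    ... | no b≢v   = contradiction (b , b∈B , b≢v) ∄other

  Simplicial : Fin n → Set
  Simplicial v = ∀ a b → Adj G v a → Adj G v b → a ≢ b → Adj G a b

  Simplicial? : Decidable Simplicial
  Simplicial? v = all? λ a → all? λ b → Adj? G v a →-dec Adj? G v b →-dec ¬? (a ≟ᶠ b) →-dec Adj? G a b

  uncut⇒simplicial : IsBlockGraph G → ∀ {B v} → Block G B → UncutVertex G B v → Simplicial v
  uncut⇒simplicial blockGraph blk (v∈B , v-uncut) a b va vb =
    blockGraph _ blk a b (neighbour∈block blk v∈B v-uncut va) (neighbour∈block blk v∈B v-uncut vb)

  -- A walk through v can shortcut a → v → b by the edge a b.
  simplicial⇒uncut : Connected G → ∀ {v} → Simplicial v → ¬ CutVertex G v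
  simplicial⇒uncut (_ , connected) {v} simplicial (_ , u , w , _ , _ , u≢v , w≢v , ¬walk) =
    ¬walk (avoid u≢v (connected u w ∈⊤ ∈⊤))
    where
    avoid : ∀ {a} → a ≢ v → WalkIn G (_∈ˢ ⊤) a w → WalkIn G (λ q → q ∈ˢ ⊤ × q ≢ v) a w
    avoid a≢v (here p) = here (p , a≢v)
    avoid {a} a≢v (step {v = b} p ab bw) with b ≟ᶠ v
    ... | no b≢v = step (p , a≢v) ab (avoid b≢v bw)
    avoid a≢v (step p ab (here _))            | yes refl = contradiction refl w≢v
    avoid {a} a≢v (step p ab (step {v = c} _ vc cw)) | yes refl with a ≟ᶠ c
    ... | yes refl = avoid a≢v cw
    ... | no a≢c   = step (p , a≢v) (simplicial a c (Adj-sym G ab) vc a≢c) (avoid (Adj⇒≢ G vc ∘ sym) cw)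

  OtherSupport : (Fin n → ℕ) → Fin n → Fin n → Set
  OtherSupport f v u = ∃ λ w → Adj G u w × w ≢ v × f w ≢ 0

  OtherSupport? : ∀ f v → Decidable (OtherSupport f v)
  OtherSupport? f v u = any? λ w → Adj? G u w ×-dec ¬? (w ≟ᶠ v) ×-dec ¬? (f w ≟ⁿ 0)

  PrivateNeighbour : (Fin n → ℕ) → Fin n → Fin n → Set
  PrivateNeighbour f v u = Adj G v u × ¬ OtherSupport f v u

  -- Otherwise lowering f v from 2 to 1 would give a lighter IIDF.
  private-neighbour-exists : ∀ {f v} → IsMinIIDF G f → f v ≡ 2 → ∃ (PrivateNeighbour f v)
  private-neighbour-exists {f} {v} (((bounded , italian) , indep) , minimal) fv≡2
    with any? (λ u → Adj? G v u ×-dec ¬? (OtherSupport? f v u))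
  ... | yes found = found
  ... | no ∄private = contradiction (minimal h ((h-bounded , h-italian) , h-indep)) (<⇒≱ h-lighter)
    where
    h = updateAt f v (const 1)

    h-bounded : ∀ a → h a ≤ 2
    h-bounded a with updateAt-const f v 1 a
    ... | inj₁ (_ , ha≡1)  = ≤-trans (≤-reflexive ha≡1) (s≤s z≤n)
    ... | inj₂ (_ , ha≡fa) = ≤-trans (≤-reflexive ha≡fa) (bounded a)

    same-support : ∀ a → h a ≢ 0 → f a ≢ 0
    same-support a ha≢0 with updateAt-const f v 1 a
    ... | inj₁ (refl , _)  = λ fv≡0 → contradiction (trans (sym fv≡2) fv≡0) λ ()
    ... | inj₂ (_ , ha≡fa) = ha≢0 ∘ trans ha≡fa

    h-indep : IsIndependentFn G h
    h-indep a b ha≢0 hb≢0 = indep a b (same-support a ha≢0) (same-support b hb≢0)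

    h-italian : ∀ w → h w ≡ 0 → 2 ≤ nbrSum G h w
    h-italian w hw≡0 with updateAt-const f v 1 w
    ... | inj₁ (_ , hw≡1) = contradiction (trans (sym hw≡1) hw≡0) λ ()
    ... | inj₂ (w≢v , hw≡fw) with Adj? G w v
    ...   | no ¬wv = subst (2 ≤_) (nbrSum-cong G w λ u wu → sym (updateAt-minimal u v f λ { refl → ¬wv wu }))
                       (italian w (trans (sym hw≡fw) hw≡0))
    ...   | yes wv with decidable-stable (OtherSupport? f v w) (λ ¬other → ∄private (w , Adj-sym G wv , ¬other))
    ...     | q , wq , q≢v , fq≢0 = ≤-trans 2≤hv+hq (+-≤-nbrSum G h wv wq (q≢v ∘ sym))
      where
      2≤hv+hq : 2 ≤ h v + h q
      2≤hv+hq = subst₂ (λ a b → 2 ≤ a + b) (sym (updateAt-updates v f)) (sym (updateAt-minimal q v f q≢v))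
                       (s≤s (n≢0⇒n>0 fq≢0))

    h-lighter : weight h < weight f
    h-lighter = ≤-reflexive (+-cancelʳ-≡ 1 _ _ (begin
      suc (weight h) + 1  ≡⟨ +-suc (weight h) 1 ⟨
      weight h + 2        ≡⟨ cong (weight h +_) fv≡2 ⟨
      weight h + f v      ≡⟨ weight-updateAt f v 1 ⟩
      weight f + 1        ∎))
      where open ≡-Reasoning

  shift-to-private : ∀ {f v u} → Simplicial v → IsMinIIDF G f → f v ≡ 2 → PrivateNeighbour f v u →
                     IsMinIIDF G (shift f v u)
  shift-to-private {f} {v} {u} simplicial (((bounded , italian) , indep) , minimal) fv≡2 (vu , ¬other) =
    ((g-bounded , g-italian) , g-indep) , λ h h-IIDF → subst (_≤ weight h) (sym same-weight) (minimal h h-IIDF)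
    where
    g = shift f v u

    fu≡0 : f u ≡ 0
    fu≡0 = decidable-stable (f u ≟ⁿ 0) λ fu≢0 →
      indep v u (λ fv≡0 → contradiction (trans (sym fv≡2) fv≡0) λ ()) fu≢0 vu

    same-weight : weight g ≡ weight f
    same-weight = weight-shift f (Adj⇒≢ G vu ∘ sym) fu≡0 fv≡2

    gu≡2 : g u ≡ 2
    gu≡2 = updateAt-updates u _

    g-bounded : ∀ a → g a ≤ 2
    g-bounded a with shift-cases f v u a
    ... | inj₁ (_ , ga≡2)              = ≤-reflexive ga≡2
    ... | inj₂ (inj₁ (_ , _ , ga≡0))   = ≤-trans (≤-reflexive ga≡0) z≤n
    ... | inj₂ (inj₂ (_ , _ , ga≡fa)) = ≤-trans (≤-reflexive ga≡fa) (bounded a)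

    support : ∀ a → g a ≢ 0 → a ≡ u ⊎ (a ≢ v × f a ≢ 0)
    support a ga≢0 with shift-cases f v u a
    ... | inj₁ (a≡u , _)                 = inj₁ a≡u
    ... | inj₂ (inj₁ (_ , _ , ga≡0))     = contradiction ga≡0 ga≢0
    ... | inj₂ (inj₂ (_ , a≢v , ga≡fa)) = inj₂ (a≢v , ga≢0 ∘ trans ga≡fa)

    g-indep : IsIndependentFn G g
    g-indep a b ga≢0 gb≢0 ab with support a ga≢0 | support b gb≢0
    ... | inj₁ refl             | inj₁ refl             = Adj⇒≢ G ab refl
    ... | inj₁ refl             | inj₂ (b≢v , fb≢0)   = ¬other (b , ab , b≢v , fb≢0)
    ... | inj₂ (a≢v , fa≢0)   | inj₁ refl             = ¬other (a , Adj-sym G ab , a≢v , fa≢0)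
    ... | inj₂ (_ , fa≢0)     | inj₂ (_ , fb≢0)     = indep a b fa≢0 fb≢0 ab

    g-italian : ∀ w → g w ≡ 0 → 2 ≤ nbrSum G g w
    g-italian w gw≡0 with shift-cases f v u w
    ... | inj₁ (_ , gw≡2)            = contradiction (trans (sym gw≡2) gw≡0) λ ()
    ... | inj₂ (inj₁ (refl , _ , _)) = subst (_≤ nbrSum G g v) gu≡2 (≤-nbrSum G g vu)
    ... | inj₂ (inj₂ (w≢u , w≢v , gw≡fw)) with Adj? G w u | Adj? G w v
    ...   | yes wu | _      = subst (_≤ nbrSum G g w) gu≡2 (≤-nbrSum G g wu)
    ...   | no ¬wu | yes wv = contradiction (simplicial w u (Adj-sym G wv) vu w≢u) ¬wu
    ...   | no ¬wu | no ¬wv =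
      subst (2 ≤_) (nbrSum-cong G w λ q wq → sym (shift-elsewhere f (λ { refl → ¬wu wq }) (λ { refl → ¬wv wq })))
        (italian w (trans (sym gw≡fw) gw≡0))

  Settled : (Fin n → ℕ) → Fin n → Set
  Settled f w = ∀ B → Block G B → Type1 G B → UncutVertex G B w → f w ≤ 1

  module _ (connected : Connected G) (blockGraph : IsBlockGraph G) where

    -- v would be a second uncut vertex of the block of u.
    simplicial-neighbour-not-type1-uncut : ∀ {u v B} → Adj G v u → Simplicial v → Block G B → Type1 G B →
                                           ¬ UncutVertex G B u
    simplicial-neighbour-not-type1-uncut vu simplicial blk (_ , _ , only) (u∈B , u-uncut) =
      Adj⇒≢ G vu (trans (only _ (v∈B , simplicial⇒uncut connected simplicial)) (sym (only _ (u∈B , u-uncut))))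
      where
      v∈B = neighbour∈block blk u∈B u-uncut (Adj-sym G vu)

    settle-by-shift : ∀ {f v} → IsMinIIDF G f → f v ≡ 2 → Simplicial v →
                      ∃ λ g → IsMinIIDF G g × Settled g v × (∀ w → Settled f w → Settled g w)
    settle-by-shift {f} {v} min fv≡2 simplicial with private-neighbour-exists min fv≡2
    ... | u , u-private@(vu , _) =
      shift f v u , shift-to-private simplicial min fv≡2 u-private ,
      g-settled v (λ v≢v → contradiction refl v≢v) , λ w settled → g-settled w λ _ → settled
      where
      g-settled : ∀ w → (w ≢ v → Settled f w) → Settled (shift f v u) w
      g-settled w settled B blk type1 uncut with shift-cases f v u w
      ... | inj₁ (refl , _)                 =
        contradiction uncut (simplicial-neighbour-not-type1-uncut vu simplicial blk type1)
      ... | inj₂ (inj₁ (_ , _ , gw≡0))     = ≤-trans (≤-reflexive gw≡0) z≤n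
      ... | inj₂ (inj₂ (_ , w≢v , gw≡fw)) = subst (_≤ 1) (sym gw≡fw) (settled w≢v B blk type1 uncut)

    settle : ∀ {f} → IsMinIIDF G f → ∀ v →
             ∃ λ g → IsMinIIDF G g × Settled g v × (∀ w → Settled f w → Settled g w)
    settle {f} min v with f v ≤? 1 | Simplicial? v
    ... | yes fv≤1 | _              = f , min , (λ _ _ _ _ → fv≤1) , λ _ settled → settled
    ... | no _     | no ¬simplicial =
      f , min , (λ _ blk _ uncut → contradiction (uncut⇒simplicial blockGraph blk uncut) ¬simplicial) ,
      λ _ settled → settled
    ... | no fv≰1  | yes simplicial =
      settle-by-shift min (≤-antisym (proj₁ (proj₁ (proj₁ min)) v) (≰⇒> fv≰1)) simplicial

    settle-all : ∀ (vs : List (Fin n)) → ∃ λ f → IsMinIIDF G f × (∀ {w} → w ∈ vs → Settled f w)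
    settle-all [] with minimum-IIDF G
    ... | f , min = f , min , λ ()
    settle-all (v ∷ vs) with settle-all vs
    ... | f , min , settled with settle min v
    ...   | g , g-min , v-settled , preserved =
      g , g-min , λ { (here refl) → v-settled ; (there w∈vs) → preserved _ (settled w∈vs) }

theorem2 : ∀ {n} (G : Graph n) → Connected G → IsBlockGraph G → (∃[ c ] CutVertex G c) →
    ∃[ f ] (IsMinIIDF G f ×
      (∀ (B : Subset n) → Block G B → Type1 G B → ∀ v → UncutVertex G B v → f v ≤ 1))
theorem2 G connected blockGraph _ with settle-all G connected blockGraph (allFin _)
... | f , min , settled = f , min , λ B blk type1 v uncut → settled (∈-allFin v) B blk type1 uncut
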